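{- Let $\mathcal{A},\mathcal{B}\in\Lambda$ be $C_{01}$-cover sets. If $\mathcal{A}\preceq\mathcal{B}$, then $\mathcal{A}\le\mathcal{B}$, i.e. $\Omega_{01}(\mathcal{A})\subseteq\Omega_{01}(\mathcal{B})$.
   Context: Fix a language $L$ for coloured $m$-partite graphs ($m$ parts $V_0,\dots,V_{m-1}$, no edges inside parts, and for distinct $i,j$ a finite nonempty colour set $C_{ij}$ for edges between $V_i$ and $V_j$), and a homogeneous $m$-generic $L$-graph $G$ (every isomorphism between finite induced subgraphs extends to an automorphism; all parts countably infinite and each bipartite restriction $C_{ij}$-generic). $O(G)$ is the class of finite $L$-graphs not embeddable in $G$ all of whose proper induced subgraphs embed. A monic is a finite $L$-graph with at most one vertex in each part; for a monic $A$ with vertices in $V_i,V_j$, $F_A(E_{ij})$ is the colour of the edge (its $E_{ij}$-edge) between them. $\Lambda$ is the set of $C_{01}$-cover sets contained in $O(G)$ with exactly $|C_{01}|$ members, i.e. sets $\mathcal{A}=\{A^c:c\in C_{01}\}\subseteq O(G)$ of monics with $A^c$ having $E_{01}$-edge coloured $c$. For $c,d\in C_{01}$, $A^{d/c}$ denotes a copy of $A^d$ with $E_{01}$-edge recoloured $c$; $A^c\le_{01}A^d$ means $A^c$ embeds as an induced subgraph of $A^{d/c}$ (used also between members of different cover sets); off-$E_{01}$-isomorphic means $\le_{01}$ both ways. $\mathcal{A}\preceq\mathcal{B}$ means each maximal element of the quasi-order $(\mathcal{A},\le_{01})$ is $\le_{01}$ some maximal element of $(\mathcal{B},\le_{01})$.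 $\Omega_{01}(\mathcal{A})$ is the set of tuples $(0,1,k,l;c_{0k},c_{0l},c_{1k},c_{1l})$ with $k,l\in\{2,\dots,m-1\}$ distinct such that some $A\in\mathcal{A}$ has vertices in $V_k$ with $F_A(E_{0k})=c_{0k}$, $F_A(E_{1k})=c_{1k}$, and some (not necessarily different) $A'\in\mathcal{A}$ has vertices in $V_l$ with $F_{A'}(E_{0l})=c_{0l}$, $F_{A'}(E_{1l})=c_{1l}$. $\mathcal{A}\le\mathcal{B}$ means $\Omega_{01}(\mathcal{A})\subseteq\Omega_{01}(\mathcal{B})$. -}

module Defs where

open import Data.Nat using (ℕ; suc; _≤_; _<_)
open import Data.Fin using (Fin; zero; suc)
open import Data.List using (List; [])
open import Data.List.Membership.Propositional using (_∈_; _∉_)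
open import Data.List.Relation.Unary.All using (All)
open import Data.Product using (Σ; ∃; ∃-syntax; _×_)
open import Relation.Binary.PropositionalEquality using (_≡_; _≢_)
open import Relation.Nullary using (¬_; Dec; yes; no)
open import Function.Definitions using (Injective)
open import Data.Fin using (_≟_)
open import Data.Bool using (Bool; true; false; if_then_else_)

-- A language for coloured m-partite graphs, m = 2 + m₀ (parts V₀,…,V_{m-1};
-- we need m ≥ 2 for E₀₁ to exist).
record Lang : Set where
  field
    m₀        : ℕ
    C         : Fin (suc (suc m₀)) → Fin (suc (suc m₀)) → List ℕ
    C-sym     : ∀ i j → C i j ≡ C j i
    C-nonempty : ∀ i j → i ≢ j → C i j ≢ []

module _ (L : Lang) where
  open Lang L

  Part : Set
  Part = Fin (suc (suc m₀))

  p0 p1 : Part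
  p0 = zero
  p1 = suc zero

  -- An L-structure on vertex type V: a part for each vertex and an edge colour
  -- for each pair of vertices (only meaningful for vertices in distinct parts).
  record Str (V : Set) : Set where
    field
      part : V → Part
      col  : V → V → ℕ

  open Str public

  IsLGraph : {V : Set} → Str V → Set
  IsLGraph {V} S =
    (∀ u v → part S u ≢ part S v → col S u v ≡ col S v u) ×
    (∀ u v → part S u ≢ part S v → col S u v ∈ C (part S u) (part S v))

  Emb : {V W : Set} → Str V → Str W → Set
  Emb {V} {W} S T = Σ (V → W) λ f →
    Injective _≡_ _≡_ f ×
    (∀ u → part T (f u) ≡ part S u) ×
    (∀ u v → part S u ≢ part S v → col T (f u) (f v) ≡ col S u v)

  record LGraph : Set where
    field
      size : ℕ
      str  : Str (Fin size)
      wf   : IsLGraph str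

  open LGraph public

  restrict : {V W : Set} → Str W → (V → W) → Str V
  restrict S g = record { part = λ u → part S (g u) ; col = λ u v → col S (g u) (g v) }

  Monic : LGraph → Set
  Monic A = Injective _≡_ _≡_ (part (str A))

  EdgeCol : LGraph → Part → Part → ℕ → Set
  EdgeCol A i j c = ∃[ u ] ∃[ v ]
    (part (str A) u ≡ i × part (str A) v ≡ j × col (str A) u v ≡ c)

  is01 : Part → Part → Bool
  is01 i j with i ≟ p0 | j ≟ p1 | i ≟ p1 | j ≟ p0
  ... | yes _ | yes _ | _     | _     = true
  ... | _     | _     | yes _ | yes _ = true
  ... | _     | _     | _     | _     = false

  recolour01 : {V : Set} → Str V → ℕ → Str V
  recolour01 S c = record
    { part = part S
    ; col  = λ u v → if is01 (part S u) (part S v) then c else col S u v }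

  -- A ≤₀₁ B where A has E₀₁-colour c: A embeds in B with its E₀₁-edge recoloured c.
  _≤₀₁[_]_ : LGraph → ℕ → LGraph → Set
  A ≤₀₁[ c ] B = Emb (str A) (recolour01 (str B) c)

  EmbIn : LGraph → Str ℕ → Set
  EmbIn A G = Emb (str A) G

  -- O(G): minimal finite L-graphs not embeddable in G (every proper induced
  -- subgraph, i.e. the restriction to an injective image of Fin k with k < size,
  -- embeds in G).
  InO : Str ℕ → LGraph → Set
  InO G A = ¬ EmbIn A G ×
    (∀ k → k < size A → (g : Fin k → Fin (size A)) → Injective _≡_ _≡_ g →
      Emb (restrict (str A) g) G)

  -- Homogeneity: every isomorphism between finite induced subgraphs (given by
  -- enumerations a, b of the two vertex sets, a i ↦ b i) extends to an automorphism.
  Homogeneous : Str ℕ → Set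
  Homogeneous G = ∀ n (a b : Fin n → ℕ) →
    Injective _≡_ _≡_ a → Injective _≡_ _≡_ b →
    (∀ i → part G (a i) ≡ part G (b i)) →
    (∀ i j → part G (a i) ≢ part G (a j) → col G (a i) (a j) ≡ col G (b i) (b j)) →
    Σ (ℕ → ℕ) λ σ → Σ (ℕ → ℕ) λ τ →
      (∀ v → τ (σ v) ≡ v) × (∀ v → σ (τ v) ≡ v) ×
      (∀ v → part G (σ v) ≡ part G v) ×
      (∀ u v → part G u ≢ part G v → col G (σ u) (σ v) ≡ col G u v) ×
      (∀ i → σ (a i) ≡ b i)

  PartsInfinite : Str ℕ → Set
  PartsInfinite G = ∀ (i : Part) (b : ℕ) → ∃[ v ] (b ≤ v × part G v ≡ i)

  -- The bipartite restriction to V_i ∪ V_j is C_ij-generic (extension property):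
  -- for any finite U ⊆ V_j, any prescribed colours in C_ij on U, and any finite
  -- W, some v ∈ V_i outside W realises the prescribed colours.
  BipartiteGeneric : Str ℕ → Set
  BipartiteGeneric G = ∀ (i j : Part) → i ≢ j →
    (U : List ℕ) → All (λ u → part G u ≡ j) U →
    (f : ℕ → ℕ) → All (λ u → f u ∈ C i j) U →
    (W : List ℕ) →
    ∃[ v ] (part G v ≡ i × v ∉ W × All (λ u → col G v u ≡ f u) U)

  HomogeneousGeneric : Str ℕ → Set
  HomogeneousGeneric G =
    IsLGraph G × Homogeneous G × PartsInfinite G × BipartiteGeneric G

  -- C₀₁-cover sets: 𝒜 c = A^c for c ∈ C₀₁ (values outside C₀₁ irrelevant).
  CoverSet : Set
  CoverSet = ℕ → LGraph

  InΛ : Str ℕ → CoverSet → Set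
  InΛ G 𝒜 = ∀ c → c ∈ C p0 p1 →
    Monic (𝒜 c) × EdgeCol (𝒜 c) p0 p1 c × InO G (𝒜 c)

  Maximal : CoverSet → ℕ → Set
  Maximal 𝒜 c = ∀ d → d ∈ C p0 p1 → 𝒜 c ≤₀₁[ c ] 𝒜 d → 𝒜 d ≤₀₁[ d ] 𝒜 c

  _⪯_ : CoverSet → CoverSet → Set
  𝒜 ⪯ ℬ = ∀ c → c ∈ C p0 p1 → Maximal 𝒜 c →
    ∃[ d ] (d ∈ C p0 p1 × Maximal ℬ d × 𝒜 c ≤₀₁[ c ] ℬ d)

  -- Parts 2,…,m-1 are suc (suc x) for x : Fin m₀.
  -- Ω₀₁(𝒜) ∋ (0,1,k,l; c0k,c0l,c1k,c1l) with k = 2+x, l = 2+y, x ≢ y.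
  InΩ : CoverSet → Fin m₀ → Fin m₀ → ℕ → ℕ → ℕ → ℕ → Set
  InΩ 𝒜 x y c0k c0l c1k c1l = x ≢ y ×
    (∃[ c ] (c ∈ C p0 p1 ×
      EdgeCol (𝒜 c) p0 (suc (suc x)) c0k × EdgeCol (𝒜 c) p1 (suc (suc x)) c1k)) ×
    (∃[ d ] (d ∈ C p0 p1 ×
      EdgeCol (𝒜 d) p0 (suc (suc y)) c0l × EdgeCol (𝒜 d) p1 (suc (suc y)) c1l))

  _≤Ω_ : CoverSet → CoverSet → Set
  𝒜 ≤Ω ℬ = ∀ x y c0k c0l c1k c1l →
    InΩ 𝒜 x y c0k c0l c1k c1l → InΩ ℬ x y c0k c0l c1k c1l

-- Every element of the finite quasi-order (𝒜, ≤₀₁) lies below a maximal one,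
-- which by 𝒜 ⪯ ℬ lies below some member of ℬ.  A ≤₀₁-embedding preserves the
-- colours of all edges other than the E₀₁-edge, in particular those of E₀ₖ and
-- E₁ₖ for k ≥ 2, so every tuple of Ω₀₁(𝒜) is witnessed in ℬ.  Constructively the
-- maximal element exists only up to double negation; this is harmless because
-- the existence of a witness in ℬ is decidable.
module Submission where

open import Defs
open import Data.Nat using (ℕ; zero; suc; _≤_; s≤s⁻¹)
open import Data.Nat.Properties using (≤-refl; <-≤-trans)
import Data.Nat.Properties as ℕ
open import Data.Fin using (Fin; suc)
import Data.Fin.Properties as Fin
open import Data.List using (List; []; _∷_; length; filter)
open import Data.List.Properties using (filter-notAll)
open import Data.List.Membership.Propositional using (_∈_; find; lose)
open import Data.List.Membership.Propositional.Properties using (∈-filter⁺)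
open import Data.List.Relation.Unary.Any as Any using (here; there; any?)
open import Data.Product using (∃-syntax; _×_; _,_)
open import Data.Sum using (_⊎_; inj₁; inj₂)
open import Data.Empty using (⊥-elim)
open import Data.Bool using (Bool; true; false; if_then_else_)
open import Function using (_∘_)
open import Level using (_⊔_)
open import Relation.Binary using (Rel; Transitive; DecidableEquality)
open import Relation.Binary.PropositionalEquality
  using (_≡_; _≢_; refl; sym; trans; cong; cong₂; module ≡-Reasoning)
open import Relation.Nullary using (¬_; Dec)
open import Relation.Nullary.Decidable using (_×-dec_; ¬?; map′; decidable-stable)

¬¬-pull-∈ : ∀ {a p} {A : Set a} {P : A → Set p} (xs : List A) →
            (∀ x → x ∈ xs → ¬ ¬ P x) → ¬ ¬ (∀ x → x ∈ xs → P x)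
¬¬-pull-∈ []       _   k = k λ _ ()
¬¬-pull-∈ (x ∷ xs) ¬¬P k = ¬¬P x (here refl) λ Px →
  ¬¬-pull-∈ xs (λ y y∈ → ¬¬P y (there y∈)) λ Pxs →
    k λ { _ (here refl) → Px ; y (there y∈) → Pxs y y∈ }

module FiniteQuasiOrder {a r} {A : Set a} (_≟_ : DecidableEquality A)
                        (R : Rel A r) (R-trans : Transitive R) (X : List A) where

  IsMaximal : A → Set (a ⊔ r)
  IsMaximal m = ∀ d → d ∈ X → R m d → R d m

  MaximalAbove : A → Set (a ⊔ r)
  MaximalAbove c = ∃[ m ] (m ∈ X × IsMaximal m × (m ≡ c ⊎ R c m))

  MaximalAbove-step : ∀ {c d} → R c d → MaximalAbove d → MaximalAbove c
  MaximalAbove-step Rcd (m , m∈X , m-max , inj₁ refl) = m , m∈X , m-max , inj₂ Rcd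
  MaximalAbove-step Rcd (m , m∈X , m-max , inj₂ Rdm) = m , m∈X , m-max , inj₂ (R-trans Rcd Rdm)

  -- S contains c and everything above it, so it shrinks each time the search
  -- moves strictly upwards; n bounds its length.
  ¬¬MaximalAbove′ : ∀ n (S : List A) → length S ≤ n → ∀ c → c ∈ X → c ∈ S →
                    (∀ d → d ∈ X → R c d → d ∈ S) → ¬ ¬ MaximalAbove c
  ¬¬MaximalAbove′ zero    []      _      _ _   ()  _
  ¬¬MaximalAbove′ zero    (_ ∷ _) ()
  ¬¬MaximalAbove′ (suc n) S       |S|≤ c c∈X c∈S S-up ¬above =
    ¬¬-pull-∈ X comparable λ c-max → ¬above (c , c∈X , c-max , inj₁ refl)
    where
      S′ : List A
      S′ = filter (λ x → ¬? (x ≟ c)) S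

      |S′|≤ : length S′ ≤ n
      |S′|≤ = s≤s⁻¹ (<-≤-trans (filter-notAll _ S (Any.map (λ c≡x x≢c → x≢c (sym c≡x)) c∈S))
                               |S|≤)

      ¬¬MaximalAbove-strict : ∀ {d} → d ∈ X → R c d → ¬ R d c → ¬ ¬ MaximalAbove d
      ¬¬MaximalAbove-strict {d} d∈X Rcd ¬Rdc =
        ¬¬MaximalAbove′ n S′ |S′|≤ d d∈X (∈-filter⁺ _ (S-up d d∈X Rcd) d≢c) S′-up
        where
          d≢c : d ≢ c
          d≢c refl = ¬Rdc Rcd
          S′-up : ∀ e → e ∈ X → R d e → e ∈ S′
          S′-up e e∈X Rde = ∈-filter⁺ _ (S-up e e∈X (R-trans Rcd Rde)) λ { refl → ¬Rdc Rde }

      comparable : ∀ d → d ∈ X → ¬ ¬ (R c d → R d c)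
      comparable d d∈X ¬max = ¬max λ Rcd → ⊥-elim
        (¬¬MaximalAbove-strict d∈X Rcd (λ Rdc → ¬max λ _ → Rdc) (¬above ∘ MaximalAbove-step Rcd))

  ¬¬MaximalAbove : ∀ {c} → c ∈ X → ¬ ¬ MaximalAbove c
  ¬¬MaximalAbove {c} c∈X = ¬¬MaximalAbove′ (length X) X ≤-refl c c∈X c∈X (λ d d∈X _ → d∈X)

else-cong : ∀ {a} {A : Set a} (β : Bool) {x y u v : A} →
            (if β then u else x) ≡ y → (if β then v else x) ≡ (if β then v else y)
else-cong true  _ = refl
else-cong false x≡y = x≡y

module _ (L : Lang) where

  C₀₁ : List ℕ
  C₀₁ = Lang.C L (p0 L) (p1 L)

  recolour01-col : ∀ {W} (T : Str L W) {c x y i j} →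
                   part T x ≡ i → part T y ≡ j →
                   col (recolour01 L T c) x y ≡ (if is01 L i j then c else col T x y)
  recolour01-col T {c} {x} {y} px py =
    cong₂ (λ i j → if is01 L i j then c else col T x y) px py

  Emb-recolour01-col : ∀ {V W} {S : Str L V} (T : Str L W) {c u v i j} →
                       ((f , _) : Emb L S (recolour01 L T c)) →
                       part S u ≡ i → part S v ≡ j → i ≢ j →
                       (if is01 L i j then c else col T (f u) (f v)) ≡ col S u v
  Emb-recolour01-col T {u = u} {v} (f , _ , f-part , f-col) pu pv i≢j =
    trans (sym (recolour01-col T (trans (f-part u) pu) (trans (f-part v) pv)))
          (f-col u v λ pu≡pv → i≢j (trans (sym pu) (trans pu≡pv pv)))

  ≤₀₁-trans : ∀ {A B D a b} → _≤₀₁[_]_ L A a B → _≤₀₁[_]_ L B b D → _≤₀₁[_]_ L A a D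
  ≤₀₁-trans {A} {B} {D} {a} A≤B@(f , f-inj , f-part , _) B≤D@(g , g-inj , g-part , _) =
    g ∘ f , f-inj ∘ g-inj , part-gf , col-gf
    where
      part-gf : ∀ u → part (str D) (g (f u)) ≡ part (str A) u
      part-gf u = trans (g-part (f u)) (f-part u)

      col-gf : ∀ u v → part (str A) u ≢ part (str A) v →
               col (recolour01 L (str D) a) (g (f u)) (g (f v)) ≡ col (str A) u v
      col-gf u v pu≢pv = begin
        col (recolour01 L (str D) a) (g (f u)) (g (f v))
          ≡⟨ recolour01-col (str D) (part-gf u) (part-gf v) ⟩
        (if β then a else col (str D) (g (f u)) (g (f v)))
          ≡⟨ else-cong β (Emb-recolour01-col (str D) B≤D (f-part u) (f-part v) pu≢pv) ⟩
        (if β then a else col (str B) (f u) (f v))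
          ≡⟨ Emb-recolour01-col (str B) A≤B refl refl pu≢pv ⟩
        col (str A) u v ∎
        where
          open ≡-Reasoning
          β = is01 L (part (str A) u) (part (str A) v)

  EdgeCol-≤₀₁ : ∀ A B {c i j e} → _≤₀₁[_]_ L A c B → is01 L i j ≡ false → i ≢ j →
                EdgeCol L A i j e → EdgeCol L B i j e
  EdgeCol-≤₀₁ A B {c} A≤B@(f , _ , f-part , _) off i≢j (u , v , pu , pv , refl) =
    f u , f v , trans (f-part u) pu , trans (f-part v) pv ,
    trans (sym (cong (λ β → if β then c else col (str B) (f u) (f v)) off))
          (Emb-recolour01-col (str B) A≤B pu pv i≢j)

  Profile : LGraph L → Fin (Lang.m₀ L) → ℕ → ℕ → Set
  Profile A x a b = EdgeCol L A (p0 L) (suc (suc x)) a × EdgeCol L A (p1 L) (suc (suc x)) b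

  Profile-≤₀₁ : ∀ A B {c x a b} → _≤₀₁[_]_ L A c B → Profile A x a b → Profile B x a b
  Profile-≤₀₁ A B A≤B (e₀ , e₁) =
    EdgeCol-≤₀₁ A B A≤B refl (λ ()) e₀ , EdgeCol-≤₀₁ A B A≤B refl (λ ()) e₁

  EdgeCol? : ∀ A i j e → Dec (EdgeCol L A i j e)
  EdgeCol? A i j e = Fin.any? λ u → Fin.any? λ v →
    (part (str A) u Fin.≟ i) ×-dec (part (str A) v Fin.≟ j) ×-dec (col (str A) u v ℕ.≟ e)

  ∃Profile? : (ℬ : CoverSet L) → ∀ x a b → Dec (∃[ d ] (d ∈ C₀₁ × Profile (ℬ d) x a b))
  ∃Profile? ℬ x a b = map′ find (λ (_ , d∈ , P) → lose d∈ P) (any? (λ d →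
    EdgeCol? (ℬ d) (p0 L) (suc (suc x)) a ×-dec EdgeCol? (ℬ d) (p1 L) (suc (suc x)) b) _)

  ⪯-Profile : ∀ 𝒜 ℬ → _⪯_ L 𝒜 ℬ → ∀ {c x a b} → c ∈ C₀₁ → Profile (𝒜 c) x a b →
              ∃[ d ] (d ∈ C₀₁ × Profile (ℬ d) x a b)
  ⪯-Profile 𝒜 ℬ 𝒜⪯ℬ {c} {x} {a} {b} c∈C P =
    decidable-stable (∃Profile? ℬ x a b) λ ¬goal →
      ¬¬MaximalAbove c∈C λ (m , m∈C , m-max , c≤m) →
        let d , d∈C , _ , m≤d = 𝒜⪯ℬ m m∈C m-max in
        ¬goal (d , d∈C , Profile-≤₀₁ (𝒜 m) (ℬ d) m≤d (Profile-above c≤m))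
    where
      open FiniteQuasiOrder ℕ._≟_ (λ c d → _≤₀₁[_]_ L (𝒜 c) c (𝒜 d))
                            (λ {c d e} → ≤₀₁-trans {𝒜 c} {𝒜 d} {𝒜 e}) C₀₁
      Profile-above : ∀ {m} → m ≡ c ⊎ _≤₀₁[_]_ L (𝒜 c) c (𝒜 m) → Profile (𝒜 m) x a b
      Profile-above (inj₁ refl) = P
      Profile-above {m} (inj₂ c≤m) = Profile-≤₀₁ (𝒜 c) (𝒜 m) c≤m P

lemma6p6 : (L : Lang) (G : Str L ℕ) → HomogeneousGeneric L G →
    (𝒜 ℬ : CoverSet L) → InΛ L G 𝒜 → InΛ L G ℬ →
    _⪯_ L 𝒜 ℬ → _≤Ω_ L 𝒜 ℬ
lemma6p6 L _ _ 𝒜 ℬ _ _ 𝒜⪯ℬ _ _ _ _ _ _ (x≢y , (c , c∈C , Pc) , (d , d∈C , Pd)) =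
  x≢y , ⪯-Profile L 𝒜 ℬ 𝒜⪯ℬ c∈C Pc , ⪯-Profile L 𝒜 ℬ 𝒜⪯ℬ d∈C Pd
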